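{- For integers $n\ge1$ and $k\ge1$, $T_n(k+1)=4T_n(k)-\frac nk\binom{n+2k-1}{k-1}$.
   Context: For integers $n\ge0$, $k\ge0$, $T_n(k)=\sum_{i=1}^{n}2^{i-1}\binom{n+2k-i-1}{k-1}$, where binomial coefficients with negative lower index are $0$. -}

module Defs where

open import Data.Nat using (ℕ; zero; suc; _+_; _*_; _∸_; _^_)
open import Data.Nat.Combinatorics using (_C_)

sumFrom1 : ℕ → (ℕ → ℕ) → ℕ
sumFrom1 zero    f = 0
sumFrom1 (suc n) f = sumFrom1 n f + f (suc n)

-- T_n(k) = Σ_{i=1}^{n} 2^{i-1} binom(n+2k-i-1, k-1); binomials with lower index -1 are 0,
-- so T_n(0) = 0. For k = suc k', n + 2k - i - 1 ≥ 0 for all 1 ≤ i ≤ n (no truncation).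
T : ℕ → ℕ → ℕ
T n zero     = 0
T n (suc k') = sumFrom1 n (λ i → 2 ^ (i ∸ 1) * ((n + 2 * suc k' ∸ i ∸ 1) C k'))

{-# OPTIONS --safe #-}
-- Write k = j + 1 and B j n = C(n + 2j + 1, j). Splitting off the term i = 1 of the sum gives
-- T (n+1) (j+1) = 2 T n (j+1) + B j n. Cleared of denominators, the claim is
-- (j+1) T n (j+2) + n B j n = 4 (j+1) T n (j+1), and by this recurrence its inductive step in n
-- reduces to the binomial identity (j+1) B (j+1) n + (n+1) B j (n+1) = (2n + 4j + 4) B j n,
-- which is two applications of absorption: (k+1) C(m+1, k+1) = (m+1) C(m, k) and
-- (d+1) C(d+k+1, k) = (d+k+1) C(d+k, k).
module Submission where

open import Defs
open import Data.Nat using (ℕ; suc; _+_; _∸_; _≥_; NonZero)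
open import Data.Nat.Combinatorics using (_C_)
open import Data.Integer using (+_)
open import Data.Rational using (ℚ; _/_; _-_) renaming (_*_ to _*ℚ_)
open import Relation.Binary.PropositionalEquality using (_≡_)

open import Data.Nat using (zero; _*_; _^_; z≤n; s≤s)
open import Data.Nat.Properties
open import Data.Nat.Combinatorics using (nC1≡n; k>n⇒nCk≡0; nCk+nC[k+1]≡[n+1]C[k+1])
open import Data.Nat.Tactic.RingSolver using (solve-∀)
import Data.Integer as ℤ
import Data.Integer.Properties as ℤ
import Data.Integer.Tactic.RingSolver as ℤ-Solver
open import Data.Rational using (toℚᵘ; -_)
open import Data.Rational.Properties using (toℚᵘ-injective; toℚᵘ-fromℚᵘ; toℚᵘ-homo-+; toℚᵘ-homo‿-; toℚᵘ-homo-*)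
open import Data.Rational.Unnormalised as ℚᵘ using (ℚᵘ; mkℚᵘ; *≡*; _≃_)
open import Data.Rational.Unnormalised.Properties using (≃-refl; ≃-trans; +-cong; -‿cong; *-cong; module ≃-Reasoning)
open import Relation.Binary.PropositionalEquality using (refl; sym; trans; cong; cong₂; subst; module ≡-Reasoning)

[k+1]*[n+1]C[k+1]≡[n+1]*nCk : ∀ n k → suc k * (suc n C suc k) ≡ suc n * (n C k)
[k+1]*[n+1]C[k+1]≡[n+1]*nCk zero zero = refl
[k+1]*[n+1]C[k+1]≡[n+1]*nCk zero (suc k) =
  trans (cong (suc (suc k) *_) (k>n⇒nCk≡0 {1} {suc (suc k)} (s≤s (s≤s z≤n)))) (*-zeroʳ (suc (suc k)))
[k+1]*[n+1]C[k+1]≡[n+1]*nCk (suc n) zero = trans (+-identityʳ _) (trans (nC1≡n (suc (suc n))) (sym (*-identityʳ _)))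
[k+1]*[n+1]C[k+1]≡[n+1]*nCk (suc n) (suc k) = begin
  suc (suc k) * (suc (suc n) C suc (suc k))   ≡⟨ cong (suc (suc k) *_) (sym (nCk+nC[k+1]≡[n+1]C[k+1] (suc n) (suc k))) ⟩
  suc (suc k) * (A + B)                       ≡⟨ expand (suc k) A B ⟩
  A + (suc k * A + suc (suc k) * B)
    ≡⟨ cong₂ (λ u v → A + (u + v)) ([k+1]*[n+1]C[k+1]≡[n+1]*nCk n k) ([k+1]*[n+1]C[k+1]≡[n+1]*nCk n (suc k)) ⟩
  A + (suc n * (n C k) + suc n * (n C suc k)) ≡⟨ cong (λ x → A + x) (sym (*-distribˡ-+ (suc n) (n C k) (n C suc k))) ⟩
  A + suc n * (n C k + n C suc k)             ≡⟨ cong (λ x → A + suc n * x) (nCk+nC[k+1]≡[n+1]C[k+1] n k) ⟩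
  A + suc n * A                               ∎
  where
  open ≡-Reasoning
  A = suc n C suc k
  B = suc n C suc (suc k)
  expand : ∀ a x y → suc a * (x + y) ≡ x + (a * x + suc a * y)
  expand = solve-∀

[d+1]*[d+k+1]Ck≡[d+k+1]*[d+k]Ck : ∀ d k → suc d * (suc (d + k) C k) ≡ suc (d + k) * ((d + k) C k)
[d+1]*[d+k+1]Ck≡[d+k+1]*[d+k]Ck d zero = cong (λ m → suc m * 1) (sym (+-identityʳ d))
[d+1]*[d+k+1]Ck≡[d+k+1]*[d+k]Ck d (suc i) = +-cancelʳ-≡ (suc i * X) (suc d * X) (suc m * (m C suc i)) (begin
  suc d * X + suc i * X                      ≡⟨ *-distribʳ-+ X (suc d) (suc i) ⟨
  suc m * X                                  ≡⟨ cong (suc m *_) (nCk+nC[k+1]≡[n+1]C[k+1] m i) ⟨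
  suc m * (m C i + m C suc i)                ≡⟨ *-distribˡ-+ (suc m) (m C i) (m C suc i) ⟩
  suc m * (m C i) + suc m * (m C suc i)      ≡⟨ cong (_+ suc m * (m C suc i)) ([k+1]*[n+1]C[k+1]≡[n+1]*nCk m i) ⟨
  suc i * X + suc m * (m C suc i)            ≡⟨ +-comm (suc i * X) _ ⟩
  suc m * (m C suc i) + suc i * X            ∎)
  where
  open ≡-Reasoning
  m = d + suc i
  X = suc m C suc i

sumFrom1-head : ∀ n f → sumFrom1 (suc n) f ≡ f 1 + sumFrom1 n (λ i → f (suc i))
sumFrom1-head zero    f = sym (+-identityʳ (f 1))
sumFrom1-head (suc n) f = trans (cong (_+ f (suc (suc n))) (sumFrom1-head n f)) (+-assoc (f 1) _ _)

sumFrom1-cong : ∀ n {f g : ℕ → ℕ} → (∀ i → f (suc i) ≡ g (suc i)) → sumFrom1 n f ≡ sumFrom1 n g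
sumFrom1-cong zero    f≗g = refl
sumFrom1-cong (suc n) f≗g = cong₂ _+_ (sumFrom1-cong n f≗g) (f≗g n)

*-distribˡ-sumFrom1 : ∀ c n f → c * sumFrom1 n f ≡ sumFrom1 n (λ i → c * f i)
*-distribˡ-sumFrom1 c zero    f = *-zeroʳ c
*-distribˡ-sumFrom1 c (suc n) f =
  trans (*-distribˡ-+ c (sumFrom1 n f) (f (suc n))) (cong (_+ c * f (suc n)) (*-distribˡ-sumFrom1 c n f))

T-suc : ∀ n j → T (suc n) (suc j) ≡ 2 * T n (suc j) + (n + suc (j + j)) C j
T-suc n j = begin
  sumFrom1 (suc n) (term (suc n))                              ≡⟨ sumFrom1-head n (term (suc n)) ⟩
  term (suc n) 1 + sumFrom1 n (λ i → term (suc n) (suc i))     ≡⟨ +-comm (term (suc n) 1) _ ⟩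
  sumFrom1 n (λ i → term (suc n) (suc i)) + term (suc n) 1     ≡⟨ cong₂ _+_ later-terms first-term ⟩
  2 * T n (suc j) + (n + suc (j + j)) C j                      ∎
  where
  open ≡-Reasoning
  term : ℕ → ℕ → ℕ
  term m i = 2 ^ (i ∸ 1) * ((m + 2 * suc j ∸ i ∸ 1) C j)
  first-term : term (suc n) 1 ≡ (n + suc (j + j)) C j
  first-term = trans (*-identityˡ _) (cong (_C j) (begin
    n + 2 * suc j ∸ 1        ≡⟨ +-∸-assoc n (s≤s z≤n) ⟩
    n + (j + suc (j + 0))    ≡⟨ cong (λ x → n + x) (trans (+-suc j (j + 0)) (cong (λ x → suc (j + x)) (+-identityʳ j))) ⟩
    n + suc (j + j)          ∎))
  later-terms : sumFrom1 n (λ i → term (suc n) (suc i)) ≡ 2 * T n (suc j)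
  later-terms = begin
    sumFrom1 n (λ i → term (suc n) (suc i))  ≡⟨ sumFrom1-cong n (λ i → *-assoc 2 (2 ^ i) _) ⟩
    sumFrom1 n (λ i → 2 * term n i)          ≡⟨ *-distribˡ-sumFrom1 2 n (term n) ⟨
    2 * T n (suc j)                          ∎

binomial-term-step : ∀ n j →
  suc j * ((n + suc (suc j + suc j)) C suc j) + suc n * ((suc n + suc (j + j)) C j)
    ≡ (2 * n + 4 * suc j) * ((n + suc (j + j)) C j)
binomial-term-step n j = begin
  suc j * ((n + suc (suc j + suc j)) C suc j) + suc n * X  ≡⟨ cong (λ m → suc j * (m C suc j) + suc n * X) (shift n j) ⟩
  suc j * (suc (suc N) C suc j) + suc n * X                ≡⟨ cong (_+ suc n * X) ([k+1]*[n+1]C[k+1]≡[n+1]*nCk (suc N) j) ⟩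
  suc (suc N) * X + suc n * X                              ≡⟨ regroup n j X ⟩
  2 * (suc (n + suc j) * X)                                ≡⟨ cong (2 *_) complement ⟩
  2 * (suc N * (N C j))                                    ≡⟨ rescale n j (N C j) ⟩
  (2 * n + 4 * suc j) * (N C j)                            ∎
  where
  open ≡-Reasoning
  N = n + suc (j + j)
  X = suc N C j
  shift : ∀ n j → n + suc (suc j + suc j) ≡ suc (suc (n + suc (j + j)))
  shift = solve-∀
  regroup-odd : ∀ n j → n + suc j + j ≡ n + suc (j + j)
  regroup-odd = solve-∀
  regroup : ∀ n j X → suc (suc (n + suc (j + j))) * X + suc n * X ≡ 2 * (suc (n + suc j) * X)
  regroup = solve-∀
  rescale : ∀ n j Y → 2 * (suc (n + suc (j + j)) * Y) ≡ (2 * n + 4 * suc j) * Y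
  rescale = solve-∀
  complement : suc (n + suc j) * X ≡ suc N * (N C j)
  complement = subst (λ m → suc (n + suc j) * (suc m C j) ≡ suc m * (m C j)) (regroup-odd n j)
                     ([d+1]*[d+k+1]Ck≡[d+k+1]*[d+k]Ck (n + suc j) j)

T-recurrence-cleared : ∀ n j → suc j * T n (suc (suc j)) + n * ((n + suc (j + j)) C j) ≡ 4 * suc j * T n (suc j)
T-recurrence-cleared zero    j = trans (+-identityʳ _) (trans (*-zeroʳ (suc j)) (sym (*-zeroʳ (4 * suc j))))
T-recurrence-cleared (suc n) j rewrite T-suc n (suc j) | T-suc n j =
  +-cancelʳ-≡ (2 * n * h₀) _ _ (begin
    suc j * (2 * T₁ + h₁) + suc n * h₀′ + 2 * n * h₀    ≡⟨ split (suc j) T₁ h₁ n h₀′ h₀ ⟩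
    2 * (suc j * T₁ + n * h₀) + (suc j * h₁ + suc n * h₀′)
      ≡⟨ cong₂ (λ u v → 2 * u + v) (T-recurrence-cleared n j) (binomial-term-step n j) ⟩
    2 * (4 * suc j * T₀) + (2 * n + 4 * suc j) * h₀    ≡⟨ merge (suc j) T₀ n h₀ ⟩
    4 * suc j * (2 * T₀ + h₀) + 2 * n * h₀              ∎)
  where
  open ≡-Reasoning
  T₀ = T n (suc j)
  T₁ = T n (suc (suc j))
  h₀ = (n + suc (j + j)) C j
  h₀′ = (suc n + suc (j + j)) C j
  h₁ = (n + suc (suc j + suc j)) C suc j
  split : ∀ a T₁ h₁ n h₀′ h₀ →
    a * (2 * T₁ + h₁) + suc n * h₀′ + 2 * n * h₀ ≡ 2 * (a * T₁ + n * h₀) + (a * h₁ + suc n * h₀′)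
  split = solve-∀
  merge : ∀ a T₀ n h₀ → 2 * (4 * a * T₀) + (2 * n + 4 * a) * h₀ ≡ 4 * a * (2 * T₀ + h₀) + 2 * n * h₀
  merge = solve-∀

ℚᵘ-clear-denominator : ∀ (a b c m n : ℤ.ℤ) j → + suc j ℤ.* a ℤ.+ n ℤ.* c ≡ m ℤ.* + suc j ℤ.* b →
  mkℚᵘ m 0 ℚᵘ.* mkℚᵘ b 0 ℚᵘ.- mkℚᵘ n j ℚᵘ.* mkℚᵘ c 0 ≃ mkℚᵘ a 0
-- The denominator of the product mkℚᵘ n j ℚᵘ.* mkℚᵘ c 0 computes to suc (j * 1 + 0).
ℚᵘ-clear-denominator a b c m n j eq rewrite *-identityʳ j | +-identityʳ j = *≡* (begin
  (m ℤ.* b ℤ.* d ℤ.+ ℤ.- (n ℤ.* c) ℤ.* + 1) ℤ.* + 1  ≡⟨ normalise m b d n c ⟩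
  m ℤ.* d ℤ.* b ℤ.- n ℤ.* c                        ≡⟨ cong (ℤ._- n ℤ.* c) eq ⟨
  d ℤ.* a ℤ.+ n ℤ.* c ℤ.- n ℤ.* c                  ≡⟨ cancel d a n c ⟩
  a ℤ.* d                                          ∎)
  where
  open ≡-Reasoning
  d = + suc j
  normalise : ∀ m b d n c → (m ℤ.* b ℤ.* d ℤ.+ ℤ.- (n ℤ.* c) ℤ.* + 1) ℤ.* + 1 ≡ m ℤ.* d ℤ.* b ℤ.- n ℤ.* c
  normalise = ℤ-Solver.solve-∀
  cancel : ∀ d a n c → d ℤ.* a ℤ.+ n ℤ.* c ℤ.- n ℤ.* c ≡ a ℤ.* d
  cancel = ℤ-Solver.solve-∀

/1-clear-denominator : ∀ a b c m n j → suc j * a + n * c ≡ m * suc j * b →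
  (+ a) / 1 ≡ ((+ m) / 1) *ℚ ((+ b) / 1) - ((+ n) / suc j) *ℚ ((+ c) / 1)
/1-clear-denominator a b c m n j eq = toℚᵘ-injective lhs≃rhs
  where
  x = ((+ m) / 1) *ℚ ((+ b) / 1)
  y = ((+ n) / suc j) *ℚ ((+ c) / 1)
  product : ∀ p i q → toℚᵘ (((+ p) / suc i) *ℚ ((+ q) / 1)) ≃ mkℚᵘ (+ p) i ℚᵘ.* mkℚᵘ (+ q) 0
  product p i q = ≃-trans (toℚᵘ-homo-* ((+ p) / suc i) ((+ q) / 1))
                          (*-cong (toℚᵘ-fromℚᵘ (mkℚᵘ (+ p) i)) (toℚᵘ-fromℚᵘ (mkℚᵘ (+ q) 0)))
  eqℤ : + suc j ℤ.* + a ℤ.+ + n ℤ.* + c ≡ + m ℤ.* + suc j ℤ.* + b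
  eqℤ = begin
    + suc j ℤ.* + a ℤ.+ + n ℤ.* + c   ≡⟨ cong₂ ℤ._+_ (ℤ.pos-* (suc j) a) (ℤ.pos-* n c) ⟨
    + (suc j * a) ℤ.+ + (n * c)      ≡⟨ ℤ.pos-+ (suc j * a) (n * c) ⟨
    + (suc j * a + n * c)            ≡⟨ cong +_ eq ⟩
    + (m * suc j * b)                ≡⟨ ℤ.pos-* (m * suc j) b ⟩
    + (m * suc j) ℤ.* + b            ≡⟨ cong (ℤ._* + b) (ℤ.pos-* m (suc j)) ⟩
    + m ℤ.* + suc j ℤ.* + b          ∎
    where open ≡-Reasoning
  lhs≃rhs : toℚᵘ ((+ a) / 1) ≃ toℚᵘ (x - y)
  lhs≃rhs = begin
    toℚᵘ ((+ a) / 1)                                                     ≈⟨ toℚᵘ-fromℚᵘ (mkℚᵘ (+ a) 0) ⟩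
    mkℚᵘ (+ a) 0                                                         ≈⟨ ℚᵘ-clear-denominator (+ a) (+ b) (+ c) (+ m) (+ n) j eqℤ ⟨
    mkℚᵘ (+ m) 0 ℚᵘ.* mkℚᵘ (+ b) 0 ℚᵘ.- mkℚᵘ (+ n) j ℚᵘ.* mkℚᵘ (+ c) 0   ≈⟨ +-cong (product m 0 b) (-‿cong (product n j c)) ⟨
    toℚᵘ x ℚᵘ.- toℚᵘ y                                                   ≈⟨ +-cong (≃-refl {toℚᵘ x}) (toℚᵘ-homo‿- y) ⟨
    toℚᵘ x ℚᵘ.+ toℚᵘ (- y)                                               ≈⟨ toℚᵘ-homo-+ x (- y) ⟨
    toℚᵘ (x - y)                                                         ∎
    where open ≃-Reasoning

-- The recurrence holds for n = 0 as well, and k ≥ 1 is already implied by NonZero k.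
lemma3 : (n k : ℕ) → n ≥ 1 → k ≥ 1 → .{{_ : NonZero k}} →
    (+ T n (suc k)) / 1 ≡
      ((+ 4) / 1) *ℚ ((+ T n k) / 1) - ((+ n) / k) *ℚ ((+ ((n + (k + k) ∸ 1) C (k ∸ 1))) / 1)
lemma3 n (suc j) _ _ = /1-clear-denominator _ _ _ 4 n j
  (subst (λ m → suc j * T n (suc (suc j)) + n * (m C j) ≡ 4 * suc j * T n (suc j))
         (sym n+[k+k]∸1≡n+[2j+1]) (T-recurrence-cleared n j))
  where
  n+[k+k]∸1≡n+[2j+1] : n + (suc j + suc j) ∸ 1 ≡ n + suc (j + j)
  n+[k+k]∸1≡n+[2j+1] = trans (+-∸-assoc n (s≤s z≤n)) (cong (λ x → n + x) (+-suc j j))
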